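{- Let $G=(V,E)$ be a finite simple graph and let $A,B\subseteq V$ be two vertex subsets. Then \[ \Delta(G,A,B)=\sigma(G_{ -A})\cdot\sigma(G_{ -B})-\sigma(G)\cdot\sigma(G_{ -A-B}) \] satisfies: $\Delta(G,A,B)<0$ if $P_i(G,A,B)$ is even; $\Delta(G,A,B)=0$ if $P_i(G,A,B)$ is infinite; and $\Delta(G,A,B)>0$ if $P_i(G,A,B)$ is odd.
   Context: For a finite simple graph $H$, $\sigma(H)$ denotes the number of independent vertex sets of $H$ (subsets of vertices no two of which are adjacent), including the empty set; the graph with no vertices has $\sigma=1$. For a vertex subset $X$, $H_{ -X}$ is the graph obtained from $H$ by deleting all vertices of $X$ together with their incident edges; $H_{ -X-Y}$ means $H_{ -(X\cup Y)}$. A path $P=(v_1,\dots,v_k)$ ($k\ge 1$) of $G$ is an induced $A$-$B$-path if $V(P)\cap A=\{v_1\}$, $V(P)\cap B=\{v_k\}$, and for all $i,j$: $\{v_i,v_j\}\in E$ if and only if $|i-j|=1$. Its length is $k-1$ (the number of edges). $P_i(G,A,B)$ denotes the set of all induced $A$-$B$-paths in $G$. $P_i(G,A,B)$ is called infinite if it is empty (there is no induced $A$-$B$-path); it is called even (resp. odd) if it is nonempty and every path in it has even (resp. odd) length. -}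

module Defs where

open import Data.Nat using (ℕ; zero; suc)
open import Data.Bool using (Bool; true; false; not; _∧_; _∨_)
open import Data.Fin using (Fin; toℕ)
open import Data.Fin.Subset using (Subset; inside; outside; _∈_; _∉_; _∪_)
open import Data.Vec using (Vec; []; _∷_; lookup)
open import Data.List using (List; []; _∷_; [_]; map; _++_; length; filterᵇ; allFin)
open import Data.Integer using (ℤ; +_; _-_; _*_)
open import Data.Product using (Σ; ∃; _×_)
open import Data.Sum using (_⊎_)
open import Relation.Binary.PropositionalEquality using (_≡_)
open import Relation.Nullary using (¬_)
open import Function.Bundles using (_⇔_)
open import Function.Definitions using (Injective)

record Graph (n : ℕ) : Set where
  field
    adj   : Fin n → Fin n → Bool
    sym   : ∀ i j → adj i j ≡ adj j i
    irrefl : ∀ i → adj i i ≡ false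
open Graph public

all : ∀ {A : Set} → (A → Bool) → List A → Bool
all p [] = true
all p (x ∷ xs) = p x ∧ all p xs

subsets : ∀ n → List (Subset n)
subsets zero = [ [] ]
subsets (suc n) = map (outside ∷_) (subsets n) ++ map (inside ∷_) (subsets n)

-- S is an independent set of G_{-X}: S avoids X and no two vertices of S are adjacent
indepIn : ∀ {n} → Graph n → Subset n → Subset n → Bool
indepIn {n} G X S =
  all (λ i → not (lookup S i ∧ lookup X i)) (allFin n) ∧
  all (λ i → all (λ j → not (lookup S i ∧ lookup S j ∧ adj G i j)) (allFin n)) (allFin n)

σ- : ∀ {n} → Graph n → Subset n → ℕ
σ- {n} G X = length (filterᵇ (indepIn G X) (subsets n))

∅ : ∀ {n} → Subset n
∅ {zero} = []
∅ {suc n} = outside ∷ ∅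

σ : ∀ {n} → Graph n → ℕ
σ G = σ- G ∅

Δ : ∀ {n} → Graph n → Subset n → Subset n → ℤ
Δ G A B = (+ σ- G A) * (+ σ- G B) - (+ σ G) * (+ σ- G (A ∪ B))

-- A path with k edges: vertices v_0,…,v_k given as a function Fin (suc k) → Fin n.
record InducedPath {n} (G : Graph n) (A B : Subset n) : Set where
  field
    len   : ℕ
    v     : Fin (suc len) → Fin n
    inj   : Injective _≡_ _≡_ v
    induced : ∀ i j → (adj G (v i) (v j) ≡ true) ⇔ (toℕ i ≡ suc (toℕ j) ⊎ toℕ j ≡ suc (toℕ i))
    firstA : v Data.Fin.zero ∈ A
    onlyA  : ∀ i → v i ∈ A → v i ≡ v Data.Fin.zero
    lastB  : v (Data.Fin.fromℕ len) ∈ B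
    onlyB  : ∀ i → v i ∈ B → v i ≡ v (Data.Fin.fromℕ len)
open InducedPath public

data Even : ℕ → Set where
  ev0 : Even zero
  ev2 : ∀ {m} → Even m → Even (suc (suc m))

data Odd : ℕ → Set where
  od1 : Odd (suc zero)
  od2 : ∀ {m} → Odd m → Odd (suc (suc m))

-- P_i(G,A,B) infinite: there is no induced A-B-path
PInfinite : ∀ {n} → Graph n → Subset n → Subset n → Set
PInfinite G A B = ¬ InducedPath G A B

PEven : ∀ {n} → Graph n → Subset n → Subset n → Set
PEven G A B = InducedPath G A B × (∀ (P : InducedPath G A B) → Even (len P))

POdd : ∀ {n} → Graph n → Subset n → Subset n → Set
POdd G A B = InducedPath G A B × (∀ (P : InducedPath G A B) → Odd (len P))

module Submission where

-- Δ(G,A,B) is the number of pairs (I , J) of independent sets with I ∩ A = ∅ and J ∩ B = ∅ minus the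
-- number of pairs with J ∩ (A ∪ B) = ∅. For any pair, G restricted to D = I △ J is bipartite with
-- sides I ∖ J and J ∖ I; exchanging I and J on the union C of the components of G[D] that meet A is an
-- involution on pairs. If C meets B, some induced A-B path lies inside D, and it is odd exactly when its
-- ends lie on opposite sides. Hence without odd induced A-B paths the exchange maps
-- pairs of the first kind to pairs of the second kind, without even ones conversely, and without any
-- path both ways. Splitting the vertices of one induced path by the parity of their position gives a
-- pair on which the inequality is strict.

open import Algebra.Definitions using (Involutive)
open import Data.Bool using (Bool; true; false; not; _∧_; _∨_; _xor_; if_then_else_)
import Data.Bool as Bool
open import Data.Bool.ListAction using (any)
open import Data.Bool.Properties
  using (∨-conicalˡ; ∨-conicalʳ; ∧-zeroʳ; ∨-zeroʳ; T-≡; not-¬; ¬-not; not-involutive; not-distribˡ-xor;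
         xor-assoc; xor-comm; xor-same; xor-identityʳ)
open import Data.Empty using (⊥)
open import Data.Fin using (Fin; zero; suc; toℕ; fromℕ; fromℕ<)
import Data.Fin as Fin
open import Data.Fin.Properties using (toℕ-injective; toℕ-fromℕ; toℕ-fromℕ<; toℕ<n; any?)
open import Data.Fin.Subset using (Subset; inside; outside; _∪_; _∩_; _∈_; _⊆_; ∣_∣)
open import Data.Fin.Subset.Properties using (⊆-antisym; _⊂?_; _∈?_; p⊂q⇒∣p∣<∣q∣; ∣p∣≤n)
import Data.Integer as ℤ
open import Data.Integer using (0ℤ; _⊖_)
open import Data.Integer.Properties using (pos-*; m-n≡m⊖n; ⊖-monoˡ-<; n⊖n≡0)
open import Data.List using (List; []; _∷_; map; _++_; length; filterᵇ; cartesianProduct)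
import Data.List as List
open import Data.List.Membership.Propositional using () renaming (_∈_ to _∈ˡ_)
open import Data.List.Relation.Unary.Any using (here; there)
import Data.List.Relation.Unary.Any.Properties as Any
open import Data.List.Relation.Unary.Any.Properties using (any⁺; any⁻)
open import Data.Nat
  using (ℕ; zero; suc; _+_; _*_; _≤_; _<_; _≤?_; _≤′_; ≤′-refl; ≤′-step; z≤n; s≤s; s≤s⁻¹)
open import Data.Nat.GeneralisedArithmetic using (fold)
open import Data.Nat.Properties
open import Algebra.Properties.CommutativeSemigroup +-commutativeSemigroup using (interchange)
open import Data.Product using (Σ; ∃-syntax; _×_; _,_; proj₁; proj₂; uncurry)
open import Data.Product.Properties using (,-injective; ≡-dec)
open import Data.Sum using (_⊎_; inj₁; inj₂; [_,_]′)
open import Data.Vec using (_∷_; []; lookup)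
import Data.Vec as Vec
import Data.Vec.Properties as Vec
open import Function using (id; _∘_; _⇔_; mk⇔; Equivalence)
open Equivalence using (to; from)
open import Relation.Binary.Definitions using (DecidableEquality; tri<; tri≈; tri>)
open import Relation.Binary.PropositionalEquality
open import Relation.Nullary using (¬_; Dec; yes; no; does; contradiction)
open import Relation.Nullary.Decidable using (dec-true; dec-false; does-⇔; _×-dec_)

open import Defs hiding (sym)

does≡true⇒ : ∀ {P : Set} (P? : Dec P) → does P? ≡ true → P
does≡true⇒ (yes p) _ = p

∧≡true⇔ : ∀ {a b} → a ∧ b ≡ true ⇔ (a ≡ true × b ≡ true)
∧≡true⇔ {true} = mk⇔ (refl ,_) proj₂
∧≡true⇔ {false} = mk⇔ (λ ()) (λ ())

∧≡false⇔ : ∀ {a b} → a ∧ b ≡ false ⇔ (a ≡ true → b ≡ false)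
∧≡false⇔ {true} = mk⇔ (λ b≡false _ → b≡false) (λ a⇒b → a⇒b refl)
∧≡false⇔ {false} = mk⇔ (λ _ ()) (λ _ → refl)

∨≡true⇔ : ∀ {a b} → a ∨ b ≡ true ⇔ (a ≡ true ⊎ b ≡ true)
∨≡true⇔ {true} = mk⇔ (λ _ → inj₁ refl) (λ _ → refl)
∨≡true⇔ {false} = mk⇔ inj₂ (λ { (inj₁ ()) ; (inj₂ b≡true) → b≡true })

not≡true⇔ : ∀ {a} → not a ≡ true ⇔ a ≡ false
not≡true⇔ {true} = mk⇔ (λ ()) (λ ())
not≡true⇔ {false} = mk⇔ (λ _ → refl) (λ _ → refl)

xor-cancelʳ : ∀ a c → (a xor c) xor c ≡ a
xor-cancelʳ a c = trans (xor-assoc a c c) (trans (cong (a xor_) (xor-same c)) (xor-identityʳ a))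

xor-cancelˡ : ∀ a b → a xor (a xor b) ≡ b
xor-cancelˡ true b = not-involutive b
xor-cancelˡ false b = refl

xor≡true⇒≡not : ∀ {a b} → a xor b ≡ true → a ≡ not b
xor≡true⇒≡not {true} {false} _ = refl
xor≡true⇒≡not {false} {true} _ = refl

xor-sides : ∀ {i j c} → i xor c ≡ true → (c ≡ true → i xor j ≡ true) →
            (c ≡ false × i ≡ true) ⊎ (c ≡ true × j ≡ true)
xor-sides {true} {_} {false} _ _ = inj₁ (refl , refl)
xor-sides {false} {_} {true} _ c⇒i⊕j = inj₂ (refl , c⇒i⊕j refl)

⟦_⟧ : Bool → ℕ
⟦ true ⟧ = 1
⟦ false ⟧ = 0

⟦⟧-mono : ∀ {a b} → (a ≡ true → b ≡ true) → ⟦ a ⟧ ≤ ⟦ b ⟧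
⟦⟧-mono {false} _ = z≤n
⟦⟧-mono {true} a⇒b rewrite a⇒b refl = ≤-refl

⟦⟧-∧ : ∀ a b → ⟦ a ∧ b ⟧ ≡ ⟦ a ⟧ * ⟦ b ⟧
⟦⟧-∧ true b = sym (+-identityʳ ⟦ b ⟧)
⟦⟧-∧ false b = refl

∑ : {A : Set} → List A → (A → ℕ) → ℕ
∑ [] f = 0
∑ (x ∷ xs) f = f x + ∑ xs f

module _ {A : Set} where

  ∑-cong : ∀ xs {f g : A → ℕ} → (∀ x → f x ≡ g x) → ∑ xs f ≡ ∑ xs g
  ∑-cong [] f≗g = refl
  ∑-cong (x ∷ xs) f≗g = cong₂ _+_ (f≗g x) (∑-cong xs f≗g)

  ∑-mono-≤ : ∀ xs {f g : A → ℕ} → (∀ x → f x ≤ g x) → ∑ xs f ≤ ∑ xs g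
  ∑-mono-≤ [] f≤g = z≤n
  ∑-mono-≤ (x ∷ xs) f≤g = +-mono-≤ (f≤g x) (∑-mono-≤ xs f≤g)

  ∑-mono-< : ∀ xs {f g : A → ℕ} → (∀ x → f x ≤ g x) →
             ∀ {x₀} → x₀ ∈ˡ xs → f x₀ < g x₀ → ∑ xs f < ∑ xs g
  ∑-mono-< (x ∷ xs) f≤g (here refl) fx<gx = +-mono-<-≤ fx<gx (∑-mono-≤ xs f≤g)
  ∑-mono-< (x ∷ xs) f≤g (there x₀∈xs) fx<gx = +-mono-≤-< (f≤g x) (∑-mono-< xs f≤g x₀∈xs fx<gx)

  ∑-zero : ∀ (xs : List A) → ∑ xs (λ _ → 0) ≡ 0
  ∑-zero [] = refl
  ∑-zero (x ∷ xs) = ∑-zero xs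

  ∑-distrib-+ : ∀ xs (f g : A → ℕ) → ∑ xs (λ x → f x + g x) ≡ ∑ xs f + ∑ xs g
  ∑-distrib-+ [] f g = refl
  ∑-distrib-+ (x ∷ xs) f g = begin
    f x + g x + ∑ xs (λ x → f x + g x) ≡⟨ cong ((f x + g x) +_) (∑-distrib-+ xs f g) ⟩
    f x + g x + (∑ xs f + ∑ xs g)      ≡⟨ interchange (f x) (g x) (∑ xs f) (∑ xs g) ⟩
    f x + ∑ xs f + (g x + ∑ xs g)      ∎
    where open ≡-Reasoning

  ∑-*ˡ : ∀ xs (c : ℕ) (f : A → ℕ) → c * ∑ xs f ≡ ∑ xs (λ x → c * f x)
  ∑-*ˡ [] c f = *-zeroʳ c
  ∑-*ˡ (x ∷ xs) c f = trans (*-distribˡ-+ c (f x) (∑ xs f)) (cong (c * f x +_) (∑-*ˡ xs c f))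

  ∑-*ʳ : ∀ xs (c : ℕ) (f : A → ℕ) → ∑ xs f * c ≡ ∑ xs (λ x → f x * c)
  ∑-*ʳ [] c f = refl
  ∑-*ʳ (x ∷ xs) c f = trans (*-distribʳ-+ c (f x) (∑ xs f)) (cong (f x * c +_) (∑-*ʳ xs c f))

  ∑-++ : ∀ xs ys (f : A → ℕ) → ∑ (xs ++ ys) f ≡ ∑ xs f + ∑ ys f
  ∑-++ [] ys f = refl
  ∑-++ (x ∷ xs) ys f = trans (cong (f x +_) (∑-++ xs ys f)) (sym (+-assoc (f x) _ _))

  ∑-map : ∀ {B : Set} (g : B → A) xs (f : A → ℕ) → ∑ (map g xs) f ≡ ∑ xs (f ∘ g)
  ∑-map g [] f = refl
  ∑-map g (x ∷ xs) f = cong (f (g x) +_) (∑-map g xs f)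

  length-filterᵇ : ∀ (p : A → Bool) xs → length (filterᵇ p xs) ≡ ∑ xs (⟦_⟧ ∘ p)
  length-filterᵇ p [] = refl
  length-filterᵇ p (x ∷ xs) with p x
  ... | true = cong suc (length-filterᵇ p xs)
  ... | false = length-filterᵇ p xs

module _ {A B : Set} where

  ∑-comm : ∀ (xs : List A) (ys : List B) (h : A → B → ℕ) →
           ∑ xs (λ x → ∑ ys (h x)) ≡ ∑ ys (λ y → ∑ xs (λ x → h x y))
  ∑-comm [] ys h = sym (∑-zero ys)
  ∑-comm (x ∷ xs) ys h =
    trans (cong (∑ ys (h x) +_) (∑-comm xs ys h)) (sym (∑-distrib-+ ys (h x) _))

  ∑-cartesianProduct : ∀ (xs : List A) (ys : List B) (h : A × B → ℕ) →
    ∑ (cartesianProduct xs ys) h ≡ ∑ xs (λ x → ∑ ys (λ y → h (x , y)))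
  ∑-cartesianProduct [] ys h = refl
  ∑-cartesianProduct (x ∷ xs) ys h = begin
    ∑ (map (x ,_) ys ++ cartesianProduct xs ys) h
      ≡⟨ ∑-++ (map (x ,_) ys) _ h ⟩
    ∑ (map (x ,_) ys) h + ∑ (cartesianProduct xs ys) h
      ≡⟨ cong₂ _+_ (∑-map (x ,_) ys h) (∑-cartesianProduct xs ys h) ⟩
    ∑ ys (λ y → h (x , y)) + ∑ xs (λ x → ∑ ys (λ y → h (x , y))) ∎
    where open ≡-Reasoning

  ∑-*-∑ : ∀ (xs : List A) (ys : List B) (f : A → ℕ) (g : B → ℕ) →
    ∑ xs f * ∑ ys g ≡ ∑ (cartesianProduct xs ys) (λ (x , y) → f x * g y)
  ∑-*-∑ xs ys f g = begin
    ∑ xs f * ∑ ys g                            ≡⟨ ∑-*ʳ xs (∑ ys g) f ⟩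
    ∑ xs (λ x → f x * ∑ ys g)                  ≡⟨ ∑-cong xs (λ x → ∑-*ˡ ys (f x) g) ⟩
    ∑ xs (λ x → ∑ ys (λ y → f x * g y))        ≡⟨ ∑-cartesianProduct xs ys _ ⟨
    ∑ (cartesianProduct xs ys) (λ (x , y) → f x * g y) ∎
    where open ≡-Reasoning

module Enumeration {A : Set} (_≟_ : DecidableEquality A) where

  δ : A → A → ℕ
  δ x y = ⟦ does (x ≟ y) ⟧

  δ-refl : ∀ x → δ x x ≡ 1
  δ-refl x = cong ⟦_⟧ (dec-true (x ≟ x) refl)

  δ-≢ : ∀ {x y} → x ≢ y → δ x y ≡ 0
  δ-≢ {x} {y} x≢y = cong ⟦_⟧ (dec-false (x ≟ y) x≢y)

  Enumerates : List A → Set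
  Enumerates xs = ∀ x → ∑ xs (δ x) ≡ 1

  ∑δ≢0⇒∈ : ∀ {x} xs → ∑ xs (δ x) ≢ 0 → x ∈ˡ xs
  ∑δ≢0⇒∈ [] ∑≢0 = contradiction refl ∑≢0
  ∑δ≢0⇒∈ {x} (y ∷ ys) ∑≢0 with x ≟ y
  ... | yes refl = here refl
  ... | no _ = there (∑δ≢0⇒∈ ys ∑≢0)

  module _ {xs : List A} (enum : Enumerates xs) where

    enumerated : ∀ x → x ∈ˡ xs
    enumerated x = ∑δ≢0⇒∈ xs (λ ∑≡0 → 1+n≢0 (trans (sym (enum x)) ∑≡0))

    ∑-select : ∀ x (f : A → ℕ) → ∑ xs (λ y → δ x y * f y) ≡ f x
    ∑-select x f = begin
      ∑ xs (λ y → δ x y * f y) ≡⟨ ∑-cong xs (δ-subst x f) ⟩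
      ∑ xs (λ y → δ x y * f x) ≡⟨ ∑-*ʳ xs (f x) (δ x) ⟨
      ∑ xs (δ x) * f x         ≡⟨ cong (_* f x) (enum x) ⟩
      1 * f x                  ≡⟨ *-identityˡ (f x) ⟩
      f x                      ∎
      where
      open ≡-Reasoning
      δ-subst : ∀ x (f : A → ℕ) y → δ x y * f y ≡ δ x y * f x
      δ-subst x f y with x ≟ y
      ... | yes refl = refl
      ... | no _ = refl

    ∑-involution : ∀ {τ : A → A} → Involutive _≡_ τ → (f : A → ℕ) → ∑ xs (f ∘ τ) ≡ ∑ xs f
    ∑-involution {τ} τ-inv f = begin
      ∑ xs (f ∘ τ)                               ≡⟨ ∑-cong xs (λ y → ∑-select (τ y) f) ⟨
      ∑ xs (λ y → ∑ xs (λ x → δ (τ y) x * f x)) ≡⟨ ∑-comm xs xs _ ⟩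
      ∑ xs (λ x → ∑ xs (λ y → δ (τ y) x * f x)) ≡⟨ ∑-cong xs (λ x → ∑-cong xs (λ y → cong (_* f x) (δ-flip x y))) ⟩
      ∑ xs (λ x → ∑ xs (λ y → δ (τ x) y * f x)) ≡⟨ ∑-cong xs (λ x → ∑-select (τ x) (λ _ → f x)) ⟩
      ∑ xs f                                     ∎
      where
      open ≡-Reasoning
      δ-flip : ∀ x y → δ (τ y) x ≡ δ (τ x) y
      δ-flip x y = cong ⟦_⟧ (does-⇔ (mk⇔ (λ τy≡x → trans (cong τ (sym τy≡x)) (τ-inv y))
                                        (λ τx≡y → trans (cong τ (sym τx≡y)) (τ-inv x)))
                                   (τ y ≟ x) (τ x ≟ y))

    module _ {τ : A → A} (τ-inv : Involutive _≡_ τ) {p q : A → Bool}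
             (p⇒q∘τ : ∀ x → p x ≡ true → q (τ x) ≡ true) where

      count-≤-involution : ∑ xs (⟦_⟧ ∘ p) ≤ ∑ xs (⟦_⟧ ∘ q)
      count-≤-involution = begin
        ∑ xs (⟦_⟧ ∘ p)     ≤⟨ ∑-mono-≤ xs (λ x → ⟦⟧-mono (p⇒q∘τ x)) ⟩
        ∑ xs (⟦_⟧ ∘ q ∘ τ) ≡⟨ ∑-involution τ-inv (⟦_⟧ ∘ q) ⟩
        ∑ xs (⟦_⟧ ∘ q)     ∎
        where open ≤-Reasoning

      count-<-involution : ∀ y → q y ≡ true → p (τ y) ≡ false → ∑ xs (⟦_⟧ ∘ p) < ∑ xs (⟦_⟧ ∘ q)
      count-<-involution y qy pτy = begin-strict
        ∑ xs (⟦_⟧ ∘ p)     <⟨ ∑-mono-< xs (λ x → ⟦⟧-mono (p⇒q∘τ x)) (enumerated (τ y)) gain ⟩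
        ∑ xs (⟦_⟧ ∘ q ∘ τ) ≡⟨ ∑-involution τ-inv (⟦_⟧ ∘ q) ⟩
        ∑ xs (⟦_⟧ ∘ q)     ∎
        where
        open ≤-Reasoning
        gain : ⟦ p (τ y) ⟧ < ⟦ q (τ (τ y)) ⟧
        gain rewrite pτy | τ-inv y | qy = ≤-refl

module _ {A B : Set} (_≟A_ : DecidableEquality A) (_≟B_ : DecidableEquality B) where
  open Enumeration _≟A_ using ()
    renaming (δ to δA; Enumerates to EnumeratesA; δ-refl to δA-refl; δ-≢ to δA-≢; ∑-select to ∑-selectA)
  open Enumeration _≟B_ using ()
    renaming (δ to δB; Enumerates to EnumeratesB; δ-refl to δB-refl; δ-≢ to δB-≢)
  open Enumeration (≡-dec _≟A_ _≟B_) using ()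
    renaming (δ to δ×; Enumerates to Enumerates×; δ-refl to δ×-refl; δ-≢ to δ×-≢)

  δ×-split : ∀ x y x′ y′ → δ× (x , y) (x′ , y′) ≡ δA x x′ * δB y y′
  δ×-split x y x′ y′ = split (x ≟A x′) (y ≟B y′)
    where
    split : Dec (x ≡ x′) → Dec (y ≡ y′) → δ× (x , y) (x′ , y′) ≡ δA x x′ * δB y y′
    split (yes refl) (yes refl) = trans (δ×-refl (x , y)) (sym (cong₂ _*_ (δA-refl x) (δB-refl y)))
    split (no x≢x′) _ =
      trans (δ×-≢ (x≢x′ ∘ proj₁ ∘ ,-injective)) (sym (cong (_* δB y y′) (δA-≢ x≢x′)))
    split (yes refl) (no y≢y′) =
      trans (δ×-≢ (y≢y′ ∘ proj₂ ∘ ,-injective))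
            (sym (trans (cong (δA x x *_) (δB-≢ y≢y′)) (*-zeroʳ (δA x x))))

  enumerates-cartesianProduct : ∀ {xs ys} → EnumeratesA xs → EnumeratesB ys → Enumerates× (cartesianProduct xs ys)
  enumerates-cartesianProduct {xs} {ys} enumA enumB (x , y) = begin
    ∑ (cartesianProduct xs ys) (δ× (x , y))           ≡⟨ ∑-cartesianProduct xs ys _ ⟩
    ∑ xs (λ x′ → ∑ ys (λ y′ → δ× (x , y) (x′ , y′))) ≡⟨ ∑-cong xs (λ x′ → ∑-cong ys (δ×-split x y x′)) ⟩
    ∑ xs (λ x′ → ∑ ys (λ y′ → δA x x′ * δB y y′))    ≡⟨ ∑-cong xs (λ x′ → ∑-*ˡ ys (δA x x′) (δB y)) ⟨
    ∑ xs (λ x′ → δA x x′ * ∑ ys (δB y))              ≡⟨ ∑-cong xs (λ x′ → cong (δA x x′ *_) (enumB y)) ⟩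
    ∑ xs (λ x′ → δA x x′ * 1)                        ≡⟨ ∑-selectA {xs} enumA x (λ _ → 1) ⟩
    1                                                ∎
    where open ≡-Reasoning

_≟ₛ_ : ∀ {n} → DecidableEquality (Subset n)
_≟ₛ_ = Vec.≡-dec Bool._≟_

∑-subsets-suc : ∀ n (h : Subset (suc n) → ℕ) →
  ∑ (subsets (suc n)) h ≡ ∑ (subsets n) (h ∘ (outside ∷_)) + ∑ (subsets n) (h ∘ (inside ∷_))
∑-subsets-suc n h = trans (∑-++ (map (outside ∷_) (subsets n)) _ h)
                          (cong₂ _+_ (∑-map (outside ∷_) (subsets n) h) (∑-map (inside ∷_) (subsets n) h))

enumerates-subsets : ∀ n → Enumeration.Enumerates _≟ₛ_ (subsets n)
enumerates-subsets zero [] = cong (_+ 0) (Enumeration.δ-refl _≟ₛ_ [])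
enumerates-subsets (suc n) (b ∷ T) = begin
  ∑ (subsets (suc n)) (δₛ (b ∷ T))
    ≡⟨ ∑-subsets-suc n (δₛ (b ∷ T)) ⟩
  ∑ (subsets n) (λ S → δₛ (b ∷ T) (outside ∷ S)) + ∑ (subsets n) (λ S → δₛ (b ∷ T) (inside ∷ S))
    ≡⟨ heads b ⟩
  1 ∎
  where
  open ≡-Reasoning
  δₛ : Subset (suc n) → Subset (suc n) → ℕ
  δₛ = Enumeration.δ _≟ₛ_
  -- With literal heads, δₛ (b ∷ T) (c ∷ S) computes to δ T S when b = c and to 0 otherwise.
  heads : ∀ b → ∑ (subsets n) (λ S → δₛ (b ∷ T) (outside ∷ S)) + ∑ (subsets n) (λ S → δₛ (b ∷ T) (inside ∷ S))
                ≡ 1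
  heads false rewrite ∑-zero (subsets n) = trans (+-identityʳ _) (enumerates-subsets n T)
  heads true rewrite ∑-zero (subsets n) = enumerates-subsets n T

all-tabulate⇔ : ∀ {A : Set} {m} (p : A → Bool) (f : Fin m → A) →
                all p (List.tabulate f) ≡ true ⇔ (∀ i → p (f i) ≡ true)
all-tabulate⇔ {m = zero} p f = mk⇔ (λ _ ()) (λ _ → refl)
all-tabulate⇔ {m = suc m} p f = mk⇔
  (λ all≡true → let head , tail = to ∧≡true⇔ all≡true in
                λ { zero → head ; (suc i) → to (all-tabulate⇔ p (f ∘ suc)) tail i })
  (λ p∘f → from ∧≡true⇔ (p∘f zero , from (all-tabulate⇔ p (f ∘ suc)) (p∘f ∘ suc)))

lookup-∅ : ∀ {n} (x : Fin n) → lookup ∅ x ≡ false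
lookup-∅ zero = refl
lookup-∅ (suc x) = lookup-∅ x

module _ {n : ℕ} where

  lookup-∪ : ∀ (p q : Subset n) x → lookup (p ∪ q) x ≡ lookup p x ∨ lookup q x
  lookup-∪ p q x = Vec.lookup-zipWith _∨_ x p q

  Disjoint : Subset n → Subset n → Set
  Disjoint S X = ∀ x → lookup S x ≡ true → lookup X x ≡ false

  Independent : Graph n → Subset n → Set
  Independent G S = ∀ x y → lookup S x ≡ true → lookup S y ≡ true → adj G x y ≡ false

  disjoint-sym : ∀ {S X} → Disjoint S X → Disjoint X S
  disjoint-sym disj x Xx = ¬-not λ Sx → not-¬ Xx (disj x Sx)

  disjoint-∅ : ∀ S → Disjoint S ∅
  disjoint-∅ S x _ = lookup-∅ x

  disjoint-∪⇔ : ∀ S X Y → Disjoint S (X ∪ Y) ⇔ (Disjoint S X × Disjoint S Y)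
  disjoint-∪⇔ S X Y = mk⇔
    (λ disj → (λ x Sx → ∨-conicalˡ _ _ (trans (sym (lookup-∪ X Y x)) (disj x Sx)))
            , (λ x Sx → ∨-conicalʳ _ _ (trans (sym (lookup-∪ X Y x)) (disj x Sx))))
    (λ (disjX , disjY) x Sx → trans (lookup-∪ X Y x) (cong₂ _∨_ (disjX x Sx) (disjY x Sx)))

  indepIn⇔ : ∀ G X S → indepIn G X S ≡ true ⇔ (Disjoint S X × Independent G S)
  indepIn⇔ G X S = mk⇔
    (λ indep → let avoid , edges = to ∧≡true⇔ indep in
      (λ x Sx → to ∧≡false⇔ (to not≡true⇔ (to (all-tabulate⇔ _ _) avoid x)) Sx)
    , (λ x y Sx Sy → to ∧≡false⇔ (to ∧≡false⇔ (to not≡true⇔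
        (to (all-tabulate⇔ _ _) (to (all-tabulate⇔ _ _) edges x) y)) Sx) Sy))
    (λ (disj , indep) → from ∧≡true⇔
      ( from (all-tabulate⇔ _ _) (λ x → from not≡true⇔ (from ∧≡false⇔ (disj x)))
      , from (all-tabulate⇔ _ _) (λ x → from (all-tabulate⇔ _ _) (λ y →
          from not≡true⇔ (from ∧≡false⇔ (λ Sx → from ∧≡false⇔ (indep x y Sx)))))))

indepIn-false : ∀ {n} (G : Graph n) X S {x} → lookup S x ≡ true → lookup X x ≡ true → indepIn G X S ≡ false
indepIn-false G X S {x} Sx Xx = ¬-not λ indep → not-¬ Xx (proj₁ (to (indepIn⇔ G X S) indep) x Sx)

_△_ : ∀ {n} → Subset n → Subset n → Subset n
_△_ = Vec.zipWith _xor_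

lookup-△ : ∀ {n} (p q : Subset n) x → lookup (p △ q) x ≡ lookup p x xor lookup q x
lookup-△ p q x = Vec.lookup-zipWith _xor_ x p q

△-cancelʳ : ∀ {n} (p r : Subset n) → (p △ r) △ r ≡ p
△-cancelʳ [] [] = refl
△-cancelʳ (a ∷ p) (c ∷ r) = cong₂ _∷_ (xor-cancelʳ a c) (△-cancelʳ p r)

△-△-cancel : ∀ {n} (p q r : Subset n) → (p △ r) △ (q △ r) ≡ p △ q
△-△-cancel [] [] [] = refl
△-△-cancel (a ∷ p) (b ∷ q) (c ∷ r) = cong₂ _∷_ xor-step (△-△-cancel p q r)
  where
  xor-step : (a xor c) xor (b xor c) ≡ a xor b
  xor-step = begin
    (a xor c) xor (b xor c) ≡⟨ cong ((a xor c) xor_) (xor-comm b c) ⟩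
    (a xor c) xor (c xor b) ≡⟨ xor-assoc (a xor c) c b ⟨
    ((a xor c) xor c) xor b ≡⟨ cong (_xor b) (xor-cancelʳ a c) ⟩
    a xor b                 ∎
    where open ≡-Reasoning

_≟ₚ_ : ∀ {n} → DecidableEquality (Subset n × Subset n)
_≟ₚ_ = ≡-dec _≟ₛ_ _≟ₛ_

allPairs : ∀ n → List (Subset n × Subset n)
allPairs n = cartesianProduct (subsets n) (subsets n)

enumerates-allPairs : ∀ n → Enumeration.Enumerates _≟ₚ_ (allPairs n)
enumerates-allPairs n =
  enumerates-cartesianProduct _≟ₛ_ _≟ₛ_ {subsets n} {subsets n} (enumerates-subsets n) (enumerates-subsets n)

count : ∀ {n} → (Subset n × Subset n → Bool) → ℕ
count {n} p = ∑ (allPairs n) (⟦_⟧ ∘ p)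

module _ {n} (G : Graph n) where

  indepPair : Subset n → Subset n → Subset n × Subset n → Bool
  indepPair X Y (I , J) = indepIn G X I ∧ indepIn G Y J

  indepPair⇔ : ∀ X Y I J → indepPair X Y (I , J) ≡ true ⇔
               ((Disjoint I X × Independent G I) × (Disjoint J Y × Independent G J))
  indepPair⇔ X Y I J = mk⇔
    (λ I,J∈ → let I∈ , J∈ = to ∧≡true⇔ I,J∈ in to (indepIn⇔ G X I) I∈ , to (indepIn⇔ G Y J) J∈)
    (λ (I∈ , J∈) → from ∧≡true⇔ (from (indepIn⇔ G X I) I∈ , from (indepIn⇔ G Y J) J∈))

  σ-*-σ : ∀ X Y → σ- G X * σ- G Y ≡ count (indepPair X Y)
  σ-*-σ X Y = begin
    σ- G X * σ- G Y
      ≡⟨ cong₂ _*_ (length-filterᵇ (indepIn G X) (subsets n)) (length-filterᵇ (indepIn G Y) (subsets n)) ⟩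
    ∑ (subsets n) (⟦_⟧ ∘ indepIn G X) * ∑ (subsets n) (⟦_⟧ ∘ indepIn G Y)
      ≡⟨ ∑-*-∑ (subsets n) (subsets n) _ _ ⟩
    ∑ (allPairs n) (λ (I , J) → ⟦ indepIn G X I ⟧ * ⟦ indepIn G Y J ⟧)
      ≡⟨ ∑-cong (allPairs n) (λ (I , J) → ⟦⟧-∧ (indepIn G X I) (indepIn G Y J)) ⟨
    count (indepPair X Y) ∎
    where open ≡-Reasoning

  Δ≡count⊖count : ∀ A B → Δ G A B ≡ count (indepPair A B) ⊖ count (indepPair ∅ (A ∪ B))
  Δ≡count⊖count A B = trans
    (cong₂ ℤ._-_ (trans (sym (pos-* (σ- G A) (σ- G B))) (cong ℤ.+_ (σ-*-σ A B)))
                 (trans (sym (pos-* (σ G) (σ- G (A ∪ B)))) (cong ℤ.+_ (σ-*-σ ∅ (A ∪ B)))))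
    (m-n≡m⊖n (count (indepPair A B)) (count (indepPair ∅ (A ∪ B))))

m<n⇒m⊖n<0 : ∀ {m n} → m < n → m ⊖ n ℤ.< 0ℤ
m<n⇒m⊖n<0 {m} {n} m<n = subst (m ⊖ n ℤ.<_) (n⊖n≡0 n) (⊖-monoˡ-< n m<n)

n<m⇒m⊖n>0 : ∀ {m n} → n < m → m ⊖ n ℤ.> 0ℤ
n<m⇒m⊖n>0 {m} {n} n<m = subst (ℤ._< m ⊖ n) (n⊖n≡0 n) (⊖-monoˡ-< n n<m)

∈⇔lookup : ∀ {n} {x : Fin n} {S : Subset n} → x ∈ S ⇔ lookup S x ≡ true
∈⇔lookup = mk⇔ Vec.[]=⇒lookup (Vec.lookup⇒[]= _ _)

⊆∧≢⇒∣∣< : ∀ {n} {p q : Subset n} → p ⊆ q → p ≢ q → ∣ p ∣ < ∣ q ∣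
⊆∧≢⇒∣∣< {p = p} {q} p⊆q p≢q with p ⊂? q
... | yes p⊂q = p⊂q⇒∣p∣<∣q∣ p⊂q
... | no p⊄q = contradiction (⊆-antisym p⊆q q⊆p) p≢q
  where
  q⊆p : q ⊆ p
  q⊆p {x} x∈q with x ∈? p
  ... | yes x∈p = x∈p
  ... | no x∉p = contradiction ((λ {y} → p⊆q {y}) , x , x∈q , x∉p) p⊄q

inflationary-fold-fixed : ∀ {n} (f : Subset n → Subset n) → (∀ p → p ⊆ f p) → ∀ p → f (fold p f n) ≡ fold p f n
inflationary-fold-fixed {n} f inflationary p = settle (growth n)
  where
  R : ℕ → Subset n
  R = fold p f
  grows : ∀ {q} → f q ≢ q → ∣ q ∣ < ∣ f q ∣
  grows {q} fq≢q = ⊆∧≢⇒∣∣< (inflationary q) (fq≢q ∘ sym)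
  growth : ∀ k → f (R k) ≡ R k ⊎ k ≤ ∣ R k ∣
  growth zero = inj₂ z≤n
  growth (suc k) with growth k | f (R k) ≟ₛ R k
  ... | inj₁ fixed | _ = inj₁ (cong f fixed)
  ... | inj₂ _ | yes fixed = inj₁ (cong f fixed)
  ... | inj₂ k≤∣Rk∣ | no moved = inj₂ (≤-<-trans k≤∣Rk∣ (grows moved))
  settle : f (R n) ≡ R n ⊎ n ≤ ∣ R n ∣ → f (R n) ≡ R n
  settle (inj₁ fixed) = fixed
  settle (inj₂ n≤∣Rn∣) with f (R n) ≟ₛ R n
  ... | yes fixed = fixed
  ... | no moved = contradiction (≤-<-trans n≤∣Rn∣ (grows moved)) (≤⇒≯ (∣p∣≤n (f (R n))))

least-witness : ∀ {P : ℕ → Set} → (∀ k → Dec (P k)) → ∀ {k} → P k →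
                ∃[ m ] P m × (∀ j → j < m → ¬ P j)
least-witness {P} P? {k} Pk = [ id , (λ none → contradiction Pk (none k ≤-refl)) ]′ (search (suc k))
  where
  search : ∀ k → (∃[ m ] P m × (∀ j → j < m → ¬ P j)) ⊎ (∀ j → j < k → ¬ P j)
  search zero = inj₂ (λ _ ())
  search (suc k) with search k | P? k
  ... | inj₁ found | _ = inj₁ found
  ... | inj₂ none | yes Pk = inj₁ (k , Pk , none)
  ... | inj₂ none | no ¬Pk = inj₂ λ j j<1+k → [ none j , (λ { refl → ¬Pk }) ]′ (m<1+n⇒m<n∨m≡n j<1+k)

≤1+∧≥1+∧≢⇒adjacent : ∀ {a c} → a ≤ suc c → c ≤ suc a → a ≢ c → a ≡ suc c ⊎ c ≡ suc a
≤1+∧≥1+∧≢⇒adjacent {a} {c} a≤1+c c≤1+a a≢c with <-cmp a c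
... | tri< a<c _ _ = inj₂ (≤-antisym c≤1+a a<c)
... | tri≈ _ a≡c _ = contradiction a≡c a≢c
... | tri> _ _ c<a = inj₁ (≤-antisym a≤1+c c<a)

odd? : ℕ → Bool
odd? zero = false
odd? (suc m) = not (odd? m)

odd?≡true⇒Odd : ∀ m → odd? m ≡ true → Odd m
odd?≡true⇒Odd (suc zero) _ = od1
odd?≡true⇒Odd (suc (suc m)) odd = od2 (odd?≡true⇒Odd m (trans (sym (not-involutive (odd? m))) odd))

odd?≡false⇒Even : ∀ m → odd? m ≡ false → Even m
odd?≡false⇒Even zero _ = ev0
odd?≡false⇒Even (suc (suc m)) even = ev2 (odd?≡false⇒Even m (trans (sym (not-involutive (odd? m))) even))

Even⇒odd?≡false : ∀ {m} → Even m → odd? m ≡ false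
Even⇒odd?≡false ev0 = refl
Even⇒odd?≡false (ev2 {m} even) = trans (not-involutive (odd? m)) (Even⇒odd?≡false even)

Odd⇒odd?≡true : ∀ {m} → Odd m → odd? m ≡ true
Odd⇒odd?≡true od1 = refl
Odd⇒odd?≡true (od2 {m} odd) = trans (not-involutive (odd? m)) (Odd⇒odd?≡true odd)

Even⇒¬Odd : ∀ {m} → Even m → ¬ Odd m
Even⇒¬Odd even odd = not-¬ (Odd⇒odd?≡true odd) (Even⇒odd?≡false even)

module _ {n} {G : Graph n} {A B : Subset n} (P : InducedPath G A B) where

  vertexAt : ∀ m → m ≤ len P → Fin n
  vertexAt m m≤len = v P (fromℕ< (s≤s m≤len))

  vertexAt-adjacent : ∀ {m} (m<len : m < len P) → adj G (vertexAt (suc m) m<len) (vertexAt m (<⇒≤ m<len)) ≡ true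
  vertexAt-adjacent {m} m<len = from (induced P _ _)
    (inj₁ (trans (toℕ-fromℕ< (s≤s m<len)) (cong suc (sym (toℕ-fromℕ< (s≤s (<⇒≤ m<len)))))))

  vertexAt-last : vertexAt (len P) ≤-refl ≡ v P (fromℕ (len P))
  vertexAt-last = cong (v P) (toℕ-injective (trans (toℕ-fromℕ< _) (sym (toℕ-fromℕ (len P)))))

  index-in-A : ∀ i → lookup A (v P i) ≡ true → i ≡ zero
  index-in-A i Avᵢ = inj P (onlyA P i (from ∈⇔lookup Avᵢ))

  index-in-B : ∀ i → lookup B (v P i) ≡ true → i ≡ fromℕ (len P)
  index-in-B i Bvᵢ = inj P (onlyB P i (from ∈⇔lookup Bvᵢ))

module Reachability {n} (G : Graph n) (A D : Subset n) where

  adjacentTo : Subset n → Fin n → Bool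
  adjacentTo P x = any (λ y → lookup P y ∧ adj G x y) (List.allFin n)

  adjacentTo⁺ : ∀ P {x} y → lookup P y ≡ true → adj G x y ≡ true → adjacentTo P x ≡ true
  adjacentTo⁺ P {x} y Py x~y =
    to T-≡ (any⁺ _ (Any.tabulate⁺ y (from T-≡ (from ∧≡true⇔ (Py , x~y)))))

  adjacentTo⁻ : ∀ P {x} → adjacentTo P x ≡ true → ∃[ y ] lookup P y ≡ true × adj G x y ≡ true
  adjacentTo⁻ P {x} adjacent =
    let y , Py∧x~y = Any.tabulate⁻ (any⁻ _ (List.allFin n) (from T-≡ adjacent))
    in y , to ∧≡true⇔ (to T-≡ Py∧x~y)

  expand : Subset n → Subset n
  expand P = Vec.tabulate λ x → lookup P x ∨ (lookup D x ∧ adjacentTo P x)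

  lookup-expand : ∀ P x → lookup (expand P) x ≡ lookup P x ∨ (lookup D x ∧ adjacentTo P x)
  lookup-expand P x = Vec.lookup∘tabulate _ x

  expand-⊇ : ∀ P {x} → lookup P x ≡ true → lookup (expand P) x ≡ true
  expand-⊇ P {x} Px = trans (lookup-expand P x) (cong (_∨ (lookup D x ∧ adjacentTo P x)) Px)

  -- Layer k consists of the vertices at distance at most k from A ∩ D in G[D]; the layers are constant
  -- from k = n on, so reach is the union of the components of G[D] that meet A.
  layer : ℕ → Subset n
  layer = fold (A ∩ D) expand

  reach : Subset n
  reach = layer n

  layer-suc-⊇ : ∀ k {x} → lookup (layer k) x ≡ true → lookup (layer (suc k)) x ≡ true
  layer-suc-⊇ k = expand-⊇ (layer k)

  layer-mono : ∀ {k m} → k ≤ m → ∀ {x} → lookup (layer k) x ≡ true → lookup (layer m) x ≡ true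
  layer-mono = go ∘ ≤⇒≤′
    where
    go : ∀ {k m} → k ≤′ m → ∀ {x} → lookup (layer k) x ≡ true → lookup (layer m) x ≡ true
    go ≤′-refl = id
    go (≤′-step {m} k≤′m) = layer-suc-⊇ m ∘ go k≤′m

  layer-stable : ∀ {m} → n ≤ m → layer m ≡ reach
  layer-stable = go ∘ ≤⇒≤′
    where
    reach-fixed : expand reach ≡ reach
    reach-fixed = inflationary-fold-fixed expand (λ P x∈P → from ∈⇔lookup (expand-⊇ P (to ∈⇔lookup x∈P))) (A ∩ D)
    go : ∀ {m} → n ≤′ m → layer m ≡ reach
    go ≤′-refl = refl
    go (≤′-step n≤′m) = trans (cong expand (go n≤′m)) reach-fixed

  layer⊆reach : ∀ k {x} → lookup (layer k) x ≡ true → lookup reach x ≡ true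
  layer⊆reach k with ≤-total k n
  ... | inj₁ k≤n = layer-mono k≤n
  ... | inj₂ n≤k = subst (λ R → lookup R _ ≡ true) (layer-stable n≤k)

  lookup-layer₀ : ∀ x → lookup (layer 0) x ≡ lookup A x ∧ lookup D x
  lookup-layer₀ x = Vec.lookup-zipWith _∧_ x A D

  layer₀⁺ : ∀ {x} → lookup A x ≡ true → lookup D x ≡ true → lookup (layer 0) x ≡ true
  layer₀⁺ {x} Ax Dx = trans (lookup-layer₀ x) (from ∧≡true⇔ (Ax , Dx))

  layer₀⊆A : ∀ {x} → lookup (layer 0) x ≡ true → lookup A x ≡ true
  layer₀⊆A {x} x∈L₀ = proj₁ (to ∧≡true⇔ (trans (sym (lookup-layer₀ x)) x∈L₀))

  expand⁻ : ∀ P {x} → lookup (expand P) x ≡ true →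
            lookup P x ≡ true ⊎ (lookup D x ≡ true × adjacentTo P x ≡ true)
  expand⁻ P {x} x∈P′ with to ∨≡true⇔ (trans (sym (lookup-expand P x)) x∈P′)
  ... | inj₁ x∈P = inj₁ x∈P
  ... | inj₂ Dx∧adjacent = inj₂ (to ∧≡true⇔ Dx∧adjacent)

  layer⊆D : ∀ k {x} → lookup (layer k) x ≡ true → lookup D x ≡ true
  layer⊆D zero {x} x∈L₀ = proj₂ (to ∧≡true⇔ (trans (sym (lookup-layer₀ x)) x∈L₀))
  layer⊆D (suc k) x∈Lₖ₊₁ with expand⁻ (layer k) x∈Lₖ₊₁
  ... | inj₁ x∈Lₖ = layer⊆D k x∈Lₖ
  ... | inj₂ (Dx , _) = Dx

  layer-adjacent : ∀ k {x y} → lookup D x ≡ true → lookup (layer k) y ≡ true → adj G x y ≡ true →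
                   lookup (layer (suc k)) x ≡ true
  layer-adjacent k {x} {y} Dx y∈Lₖ x~y = trans (lookup-expand (layer k) x)
    (from ∨≡true⇔ (inj₂ (from ∧≡true⇔ (Dx , adjacentTo⁺ (layer k) y y∈Lₖ x~y))))

  layer-new : ∀ k {x} → lookup (layer (suc k)) x ≡ true → lookup (layer k) x ≡ false →
              ∃[ y ] lookup (layer k) y ≡ true × adj G x y ≡ true
  layer-new k x∈Lₖ₊₁ x∉Lₖ with expand⁻ (layer k) x∈Lₖ₊₁
  ... | inj₁ x∈Lₖ = contradiction (trans (sym x∈Lₖ) x∉Lₖ) λ ()
  ... | inj₂ (_ , adjacent) = adjacentTo⁻ (layer k) adjacent

  reach-seed : ∀ {x} → lookup A x ≡ true → lookup D x ≡ true → lookup reach x ≡ true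
  reach-seed Ax Dx = layer⊆reach 0 (layer₀⁺ Ax Dx)

  reach⊆D : ∀ {x} → lookup reach x ≡ true → lookup D x ≡ true
  reach⊆D = layer⊆D n

  reach-closed : ∀ {x y} → lookup D x ≡ true → lookup reach y ≡ true → adj G x y ≡ true →
                 lookup reach x ≡ true
  reach-closed Dx y∈R x~y = layer⊆reach (suc n) (layer-adjacent n Dx y∈R x~y)

  AtDistance : ℕ → Fin n → Set
  AtDistance k x = lookup (layer k) x ≡ true × (∀ j → j < k → lookup (layer j) x ≡ false)

  distance-unique : ∀ {k m x} → AtDistance k x → AtDistance m x → k ≡ m
  distance-unique {k} {m} (x∈Lₖ , belowₖ) (x∈Lₘ , belowₘ) with <-cmp k m
  ... | tri< k<m _ _ = contradiction (belowₘ k k<m) (not-¬ x∈Lₖ)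
  ... | tri≈ _ k≡m _ = k≡m
  ... | tri> _ _ m<k = contradiction (belowₖ m m<k) (not-¬ x∈Lₘ)

  distance-jump : ∀ {i j x y} → AtDistance i x → AtDistance j y → adj G y x ≡ true → j ≤ suc i
  distance-jump {i} {j} (x∈Lᵢ , _) (y∈Lⱼ , belowⱼ) y~x = ≮⇒≥ λ 1+i<j →
    contradiction (belowⱼ (suc i) 1+i<j) (not-¬ (layer-adjacent i (layer⊆D j y∈Lⱼ) x∈Lᵢ y~x))

  distance-predecessor : ∀ {k x} → AtDistance (suc k) x → ∃[ y ] AtDistance k y × adj G x y ≡ true
  distance-predecessor {k} {x} (x∈Lₖ₊₁ , belowₖ₊₁) with layer-new k x∈Lₖ₊₁ (belowₖ₊₁ k ≤-refl)
  ... | y , y∈Lₖ , x~y = y , (y∈Lₖ , y-below) , x~y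
    where
    y-below : ∀ j → j < k → lookup (layer j) y ≡ false
    y-below j j<k = ¬-not λ y∈Lⱼ →
      contradiction (belowₖ₊₁ (suc j) (s≤s j<k))
                    (not-¬ (layer-adjacent j (layer⊆D (suc k) x∈Lₖ₊₁) y∈Lⱼ x~y))

  record Geodesic (k : ℕ) (x : Fin n) : Set where
    field
      vertex   : ℕ → Fin n
      endpoint : vertex k ≡ x
      distance : ∀ {i} → i ≤ k → AtDistance i (vertex i)
      step     : ∀ {i} → i < k → adj G (vertex (suc i)) (vertex i) ≡ true

  geodesic : ∀ k {x} → AtDistance k x → Geodesic k x
  geodesic zero {x} x₀ = record { vertex = λ _ → x ; endpoint = refl ; distance = λ { z≤n → x₀ } ; step = λ () }
  geodesic (suc k) {x} xₖ₊₁ with distance-predecessor xₖ₊₁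
  ... | y , yₖ , x~y = record { vertex = vertex′ ; endpoint = top ; distance = distance′ ; step = step′ }
    where
    open Geodesic (geodesic k yₖ)
    vertex′ : ℕ → Fin n
    vertex′ i = if does (i ≤? k) then vertex i else x
    below : ∀ {i} → i ≤ k → vertex′ i ≡ vertex i
    below {i} i≤k = cong (if_then vertex i else x) (dec-true (i ≤? k) i≤k)
    top : vertex′ (suc k) ≡ x
    top = cong (if_then vertex (suc k) else x) (dec-false (suc k ≤? k) (n≮n k))
    distance′ : ∀ {i} → i ≤ suc k → AtDistance i (vertex′ i)
    distance′ i≤1+k with m≤n⇒m<n∨m≡n i≤1+k
    ... | inj₁ i<1+k = subst (AtDistance _) (sym (below (s≤s⁻¹ i<1+k))) (distance (s≤s⁻¹ i<1+k))
    ... | inj₂ refl = subst (AtDistance _) (sym top) xₖ₊₁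
    step′ : ∀ {i} → i < suc k → adj G (vertex′ (suc i)) (vertex′ i) ≡ true
    step′ {i} (s≤s i≤k) with m≤n⇒m<n∨m≡n i≤k
    ... | inj₁ i<k = subst₂ (λ a b → adj G a b ≡ true) (sym (below i<k)) (sym (below i≤k)) (step i<k)
    ... | inj₂ refl = subst₂ (λ a b → adj G a b ≡ true) (sym top) (sym (trans (below ≤-refl) endpoint)) x~y

  module _ {B : Subset n} {k b} (b∈B : lookup B b ≡ true) (bₖ : AtDistance k b)
           (B-below : ∀ j {z} → j < k → lookup B z ≡ true → lookup (layer j) z ≡ false) where

    open Geodesic (geodesic k bₖ)

    private
      index≤ : (i : Fin (suc k)) → toℕ i ≤ k
      index≤ i = s≤s⁻¹ (toℕ<n i)

      adjacent⇒consecutive : ∀ {a c} → a ≤ k → c ≤ k → adj G (vertex a) (vertex c) ≡ true →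
                             a ≡ suc c ⊎ c ≡ suc a
      adjacent⇒consecutive {a} {c} a≤k c≤k a~c = ≤1+∧≥1+∧≢⇒adjacent
        (distance-jump (distance c≤k) (distance a≤k) a~c)
        (distance-jump (distance a≤k) (distance c≤k) (trans (Graph.sym G _ _) a~c))
        (λ { refl → contradiction (trans (sym a~c) (irrefl G (vertex a))) λ () })

      consecutive⇒adjacent : ∀ {a c} → a ≤ k → c ≤ k → a ≡ suc c ⊎ c ≡ suc a →
                             adj G (vertex a) (vertex c) ≡ true
      consecutive⇒adjacent a≤k c≤k (inj₁ refl) = step a≤k
      consecutive⇒adjacent a≤k c≤k (inj₂ refl) = trans (Graph.sym G _ _) (step c≤k)

      distance-index : ∀ i m → AtDistance m (vertex (toℕ i)) → toℕ i ≡ m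
      distance-index i m vertex∈m = distance-unique (distance (index≤ i)) vertex∈m

    -- A chord of a geodesic would join distances differing by at least two.
    geodesicPath : InducedPath G A B
    geodesicPath = record
      { len = k
      ; v = vertex ∘ toℕ
      ; inj = λ {i} {j} vᵢ≡vⱼ →
          toℕ-injective (distance-index i (toℕ j) (subst (AtDistance (toℕ j)) (sym vᵢ≡vⱼ) (distance (index≤ j))))
      ; induced = λ i j →
          mk⇔ (adjacent⇒consecutive (index≤ i) (index≤ j)) (consecutive⇒adjacent (index≤ i) (index≤ j))
      ; firstA = from ∈⇔lookup (layer₀⊆A (proj₁ (distance z≤n)))
      ; onlyA = λ i vᵢ∈A → cong vertex (distance-index i 0
          (layer₀⁺ (to ∈⇔lookup vᵢ∈A) (layer⊆D (toℕ i) (proj₁ (distance (index≤ i)))) , λ _ ()))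
      ; lastB = from ∈⇔lookup
          (subst (λ z → lookup B z ≡ true) (sym (trans (cong vertex (toℕ-fromℕ k)) endpoint)) b∈B)
      ; onlyB = λ i vᵢ∈B → cong vertex (trans (index-top i (to ∈⇔lookup vᵢ∈B)) (sym (toℕ-fromℕ k)))
      }
      where
      index-top : ∀ i → lookup B (vertex (toℕ i)) ≡ true → toℕ i ≡ k
      index-top i vᵢ∈B with m≤n⇒m<n∨m≡n (index≤ i)
      ... | inj₁ i<k = contradiction (B-below (toℕ i) i<k vᵢ∈B) (not-¬ (proj₁ (distance (index≤ i))))
      ... | inj₂ i≡k = i≡k

    geodesicPath-inside : ∀ i → lookup D (v geodesicPath i) ≡ true
    geodesicPath-inside i = layer⊆D (toℕ i) (proj₁ (distance (index≤ i)))

  -- Ending at a vertex of B of least distance keeps all earlier vertices of the geodesic outside B.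
  induced-path-to : ∀ {B b} → lookup B b ≡ true → lookup reach b ≡ true →
                    Σ (InducedPath G A B) λ P → ∀ i → lookup D (v P i) ≡ true
  induced-path-to {B} {b} b∈B b∈R with least-witness {P = λ m → ∃[ z ] lookup B z ∧ lookup (layer m) z ≡ true}
                                        (λ m → any? λ z → lookup B z ∧ lookup (layer m) z Bool.≟ true)
                                        {n} (b , from ∧≡true⇔ (b∈B , b∈R))
  ... | k , (b′ , b′∈B∩Lₖ) , none-below =
    geodesicPath {B} b′∈B b′ₖ B-below , geodesicPath-inside {B} b′∈B b′ₖ B-below
    where
    b′∈B : lookup B b′ ≡ true
    b′∈B = proj₁ (to ∧≡true⇔ b′∈B∩Lₖ)
    B-below : ∀ j {z} → j < k → lookup B z ≡ true → lookup (layer j) z ≡ false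
    B-below j {z} j<k z∈B = ¬-not λ z∈Lⱼ → none-below j j<k (z , from ∧≡true⇔ (z∈B , z∈Lⱼ))
    b′ₖ : AtDistance k b′
    b′ₖ = proj₂ (to ∧≡true⇔ b′∈B∩Lₖ) , λ j j<k → B-below j j<k b′∈B

  path-inside-reaches : ∀ {B} (P : InducedPath G A B) → (∀ i → lookup D (v P i) ≡ true) →
                        lookup reach (v P (fromℕ (len P))) ≡ true
  path-inside-reaches P D∋P = subst (λ z → lookup reach z ≡ true) (vertexAt-last P)
    (layer⊆reach (len P) (walk (len P) ≤-refl))
    where
    walk : ∀ m (m≤len : m ≤ len P) → lookup (layer m) (vertexAt P m m≤len) ≡ true
    walk zero _ = layer₀⁺ (to ∈⇔lookup (firstA P)) (D∋P _)
    walk (suc m) m<len = layer-adjacent m (D∋P _) (walk m (<⇒≤ m<len)) (vertexAt-adjacent P m<len)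

module _ {n} {G : Graph n} {I J D C : Subset n}
         (D≗I⊕J : ∀ x → lookup D x ≡ lookup I x xor lookup J x)
         (indI : Independent G I) (indJ : Independent G J)
         (C⊆D : ∀ {x} → lookup C x ≡ true → lookup D x ≡ true)
         (C-closed : ∀ {x y} → lookup D x ≡ true → lookup C y ≡ true → adj G x y ≡ true →
                     lookup C x ≡ true) where

  private
    Side : Fin n → Set
    Side x = (lookup C x ≡ false × lookup I x ≡ true) ⊎ (lookup C x ≡ true × lookup J x ≡ true)

    side : ∀ x → lookup (I △ C) x ≡ true → Side x
    side x x∈I△C = xor-sides (trans (sym (lookup-△ I C x)) x∈I△C) (λ Cx → trans (sym (D≗I⊕J x)) (C⊆D Cx))

    crossing : ∀ {x y} → lookup C x ≡ true → lookup J x ≡ true → lookup C y ≡ false → lookup I y ≡ true →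
               adj G x y ≡ true → ⊥
    crossing {x} {y} Cx Jx Cy̸ Iy x~y with lookup J y in Jy
    ... | true = not-¬ x~y (indJ x y Jx Jy)
    ... | false = not-¬ (C-closed (trans (D≗I⊕J y) (cong₂ _xor_ Iy Jy)) Cx (trans (Graph.sym G y x) x~y)) Cy̸

  △-closed-independent : Independent G (I △ C)
  △-closed-independent x y x∈I△C y∈I△C = ¬-not (edge (side x x∈I△C) (side y y∈I△C))
    where
    edge : Side x → Side y → adj G x y ≢ true
    edge (inj₁ (_ , Ix)) (inj₁ (_ , Iy)) x~y = not-¬ x~y (indI x y Ix Iy)
    edge (inj₂ (_ , Jx)) (inj₂ (_ , Jy)) x~y = not-¬ x~y (indJ x y Jx Jy)
    edge (inj₂ (Cx , Jx)) (inj₁ (Cy̸ , Iy)) x~y = crossing Cx Jx Cy̸ Iy x~y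
    edge (inj₁ (Cx̸ , Ix)) (inj₂ (Cy , Jy)) x~y = crossing Cy Jy Cx̸ Ix (trans (Graph.sym G y x) x~y)

module Switching {n} (G : Graph n) (A B : Subset n) where

  closure : Subset n → Subset n
  closure = Reachability.reach G A

  switch : Subset n × Subset n → Subset n × Subset n
  switch (I , J) = I △ closure (I △ J) , J △ closure (I △ J)

  switch-involutive : Involutive _≡_ switch
  switch-involutive (I , J) rewrite △-△-cancel I J (closure (I △ J)) =
    cong₂ _,_ (△-cancelʳ I (closure (I △ J))) (△-cancelʳ J (closure (I △ J)))

  module SwitchedPair {I J : Subset n} (indI : Independent G I) (indJ : Independent G J) where

    private
      D C : Subset n
      D = I △ J
      C = closure D
      open Reachability G A D

    switch-independent : Independent G (I △ C) × Independent G (J △ C)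
    switch-independent =
      △-closed-independent {G = G} {I} {J} {D} {C} (lookup-△ I J) indI indJ reach⊆D reach-closed ,
      △-closed-independent {G = G} {J} {I} {D} {C}
                           (λ x → trans (lookup-△ I J x) (xor-comm (lookup I x) (lookup J x)))
                           indJ indI reach⊆D reach-closed

    switch-swaps-on-A : ∀ {x} → lookup A x ≡ true →
                        lookup (I △ C) x ≡ lookup J x × lookup (J △ C) x ≡ lookup I x
    switch-swaps-on-A {x} Ax =
      trans (lookup-△ I C x) (trans (cong (lookup I x xor_) C≗I⊕J) (xor-cancelˡ (lookup I x) (lookup J x))) ,
      trans (lookup-△ J C x) (trans (cong (lookup J x xor_) (trans C≗I⊕J (xor-comm (lookup I x) (lookup J x))))
                                    (xor-cancelˡ (lookup J x) (lookup I x)))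
      where
      C≗D : lookup C x ≡ lookup D x
      C≗D with lookup D x in Dx
      ... | true = reach-seed Ax Dx
      ... | false = ¬-not λ Cx → not-¬ (reach⊆D Cx) Dx
      C≗I⊕J : lookup C x ≡ lookup I x xor lookup J x
      C≗I⊕J = trans C≗D (lookup-△ I J x)

    D∖J⊆I : ∀ {x} → lookup D x ≡ true → lookup J x ≡ false → lookup I x ≡ true
    D∖J⊆I {x} Dx Jx̸ = trans (sym (xor-identityʳ (lookup I x)))
      (trans (cong (lookup I x xor_) (sym Jx̸)) (trans (sym (lookup-△ I J x)) Dx))

    private
      D∖I⊆J : ∀ {x} → lookup D x ≡ true → lookup I x ≡ false → lookup J x ≡ true
      D∖I⊆J {x} Dx Ix̸ = trans (cong (_xor lookup J x) (sym Ix̸)) (trans (sym (lookup-△ I J x)) Dx)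

      edge-alternates : ∀ {x y} → lookup D x ≡ true → lookup D y ≡ true → adj G x y ≡ true →
                        lookup I x ≡ not (lookup I y)
      edge-alternates {x} {y} Dx Dy x~y with lookup I x in Ix | lookup I y in Iy
      ... | true | true = contradiction (indI x y Ix Iy) (not-¬ x~y)
      ... | false | false = contradiction (indJ x y (D∖I⊆J Dx Ix) (D∖I⊆J Dy Iy)) (not-¬ x~y)
      ... | true | false = refl
      ... | false | true = refl

    path-parity : ∀ (P : InducedPath G A B) → (∀ i → lookup D (v P i) ≡ true) →
                  lookup I (v P (fromℕ (len P))) ≡ odd? (len P) xor lookup I (v P zero)
    path-parity P D∋P = trans (cong (lookup I) (sym (vertexAt-last P))) (along (len P) ≤-refl)
      where
      along : ∀ m (m≤len : m ≤ len P) → lookup I (vertexAt P m m≤len) ≡ odd? m xor lookup I (v P zero)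
      along zero _ = refl
      along (suc m) m<len = trans (edge-alternates (D∋P _) (D∋P _) (vertexAt-adjacent P m<len))
                                  (trans (cong not (along m (<⇒≤ m<len))) (not-distribˡ-xor (odd? m) _))

    switch-disjoint-B : ∀ s → Disjoint J B →
                        (∀ {x} → lookup A x ≡ true → lookup D x ≡ true → lookup I x ≡ s) →
                        (∀ (P : InducedPath G A B) → odd? (len P) ≢ not s) → Disjoint (J △ C) B
    switch-disjoint-B s J∩B=∅ I-on-A forbidden-parity x x∈J△C = ¬-not λ Bx →
      let P , D∋P = induced-path-to Bx
                      (trans (cong (_xor lookup C x) (sym (B⊆∁J Bx))) (trans (sym (lookup-△ J C x)) x∈J△C))
          I-last = D∖J⊆I (D∋P (fromℕ (len P))) (B⊆∁J (to ∈⇔lookup (lastB P)))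
          I-first = I-on-A (to ∈⇔lookup (firstA P)) (D∋P zero)
      in forbidden-parity P (xor≡true⇒≡not
           (trans (sym (trans (path-parity P D∋P) (cong (odd? (len P) xor_) I-first))) I-last))
      where
      B⊆∁J : ∀ {y} → lookup B y ≡ true → lookup J y ≡ false
      B⊆∁J = disjoint-sym {S = J} {X = B} J∩B=∅ _

  switch-sends₁₂ : (∀ (P : InducedPath G A B) → ¬ Odd (len P)) →
                   ∀ p → indepPair G A B p ≡ true → indepPair G ∅ (A ∪ B) (switch p) ≡ true
  switch-sends₁₂ no-odd (I , J) p∈₁ with to (indepPair⇔ G A B I J) p∈₁
  ... | (I∩A=∅ , indI) , (J∩B=∅ , indJ) =
    from (indepPair⇔ G ∅ (A ∪ B) (I △ closure (I △ J)) (J △ closure (I △ J)))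
    ( (disjoint-∅ (I △ closure (I △ J)) , proj₁ switch-independent)
    , (from (disjoint-∪⇔ (J △ closure (I △ J)) A B) (J′∩A=∅ , J′∩B=∅) , proj₂ switch-independent))
    where
    open SwitchedPair {I} {J} indI indJ
    A⊆∁I : ∀ {x} → lookup A x ≡ true → lookup I x ≡ false
    A⊆∁I = disjoint-sym {S = I} {X = A} I∩A=∅ _
    J′∩A=∅ : Disjoint (J △ closure (I △ J)) A
    J′∩A=∅ x x∈J′ = ¬-not λ Ax → not-¬ (trans (sym (proj₂ (switch-swaps-on-A Ax))) x∈J′) (A⊆∁I Ax)
    J′∩B=∅ : Disjoint (J △ closure (I △ J)) B
    J′∩B=∅ = switch-disjoint-B false J∩B=∅ (λ Ax _ → A⊆∁I Ax)
                               (λ P odd → no-odd P (odd?≡true⇒Odd (len P) odd))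

  switch-sends₂₁ : (∀ (P : InducedPath G A B) → ¬ Even (len P)) →
                   ∀ p → indepPair G ∅ (A ∪ B) p ≡ true → indepPair G A B (switch p) ≡ true
  switch-sends₂₁ no-even (I , J) p∈₂ with to (indepPair⇔ G ∅ (A ∪ B) I J) p∈₂
  ... | (_ , indI) , (J∩A∪B=∅ , indJ) =
    from (indepPair⇔ G A B (I △ closure (I △ J)) (J △ closure (I △ J)))
    ( (I′∩A=∅ , proj₁ switch-independent)
    , (J′∩B=∅ , proj₂ switch-independent))
    where
    open SwitchedPair {I} {J} indI indJ
    J∩A=∅ : Disjoint J A
    J∩A=∅ = proj₁ (to (disjoint-∪⇔ J A B) J∩A∪B=∅)
    J∩B=∅ : Disjoint J B
    J∩B=∅ = proj₂ (to (disjoint-∪⇔ J A B) J∩A∪B=∅)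
    A⊆∁J : ∀ {x} → lookup A x ≡ true → lookup J x ≡ false
    A⊆∁J = disjoint-sym {S = J} {X = A} J∩A=∅ _
    I′∩A=∅ : Disjoint (I △ closure (I △ J)) A
    I′∩A=∅ x x∈I′ = ¬-not λ Ax → not-¬ (trans (sym (proj₁ (switch-swaps-on-A Ax))) x∈I′) (A⊆∁J Ax)
    J′∩B=∅ : Disjoint (J △ closure (I △ J)) B
    J′∩B=∅ = switch-disjoint-B true J∩B=∅ (λ Ax Dx → D∖J⊆I Dx (A⊆∁J Ax))
                               (λ P even → no-even P (odd?≡false⇒Even (len P) even))

  private
    module Pairs = Enumeration (_≟ₚ_ {n})

    count-≤ : ∀ {p q} → (∀ x → p x ≡ true → q (switch x) ≡ true) → count p ≤ count q
    count-≤ = Pairs.count-≤-involution {allPairs n} (enumerates-allPairs n) {switch} switch-involutive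

    count-< : ∀ {p q} → (∀ x → p x ≡ true → q (switch x) ≡ true) →
              ∀ y → q y ≡ true → p (switch y) ≡ false → count p < count q
    count-< = Pairs.count-<-involution {allPairs n} (enumerates-allPairs n) {switch} switch-involutive

  count₁≤count₂ : (∀ (P : InducedPath G A B) → ¬ Odd (len P)) →
                  count (indepPair G A B) ≤ count (indepPair G ∅ (A ∪ B))
  count₁≤count₂ no-odd = count-≤ (switch-sends₁₂ no-odd)

  count₂≤count₁ : (∀ (P : InducedPath G A B) → ¬ Even (len P)) →
                  count (indepPair G ∅ (A ∪ B)) ≤ count (indepPair G A B)
  count₂≤count₁ no-even = count-≤ (switch-sends₂₁ no-even)

  count₁<count₂ : (∀ (P : InducedPath G A B) → ¬ Odd (len P)) →
                  ∀ q → indepPair G ∅ (A ∪ B) q ≡ true → indepPair G A B (switch q) ≡ false →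
                  count (indepPair G A B) < count (indepPair G ∅ (A ∪ B))
  count₁<count₂ no-odd = count-< (switch-sends₁₂ no-odd)

  count₂<count₁ : (∀ (P : InducedPath G A B) → ¬ Even (len P)) →
                  ∀ q → indepPair G A B q ≡ true → indepPair G ∅ (A ∪ B) (switch q) ≡ false →
                  count (indepPair G ∅ (A ∪ B)) < count (indepPair G A B)
  count₂<count₁ no-even = count-< (switch-sends₂₁ no-even)

module Witness {n} {G : Graph n} {A B : Subset n} (P : InducedPath G A B) where

  open Switching G A B

  private
    k : ℕ
    k = len P
    last : Fin (suc k)
    last = fromℕ k

  visits? : ∀ b x → Dec (∃[ i ] v P i ≡ x × odd? (toℕ i) ≡ b)
  visits? b x = any? λ i → v P i Fin.≟ x ×-dec odd? (toℕ i) Bool.≟ b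

  parityClass : Bool → Subset n
  parityClass b = Vec.tabulate λ x → does (visits? b x)

  parityClass⁻ : ∀ {b x} → lookup (parityClass b) x ≡ true → ∃[ i ] v P i ≡ x × odd? (toℕ i) ≡ b
  parityClass⁻ {b} {x} x∈ = does≡true⇒ (visits? b x) (trans (sym (Vec.lookup∘tabulate _ x)) x∈)

  vertex∈parityClass : ∀ i → lookup (parityClass (odd? (toℕ i))) (v P i) ≡ true
  vertex∈parityClass i =
    trans (Vec.lookup∘tabulate _ (v P i)) (dec-true (visits? (odd? (toℕ i)) (v P i)) (i , refl , refl))

  vertex∉parityClass : ∀ {i b} → odd? (toℕ i) ≢ b → lookup (parityClass b) (v P i) ≡ false
  vertex∉parityClass {i} {b} odd?i≢b = ¬-not λ vᵢ∈ → let j , vⱼ≡vᵢ , odd?j≡b = parityClass⁻ vᵢ∈ in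
    odd?i≢b (subst (λ z → odd? (toℕ z) ≡ b) (inj P vⱼ≡vᵢ) odd?j≡b)

  parityClass-independent : ∀ b → Independent G (parityClass b)
  parityClass-independent b x y x∈ y∈ with parityClass⁻ x∈ | parityClass⁻ y∈
  ... | i , refl , odd?i | j , refl , odd?j = ¬-not λ vᵢ~vⱼ →
    consecutive-parity (to (induced P i j) vᵢ~vⱼ) (trans odd?i (sym odd?j))
    where
    consecutive-parity : ∀ {a c} → a ≡ suc c ⊎ c ≡ suc a → odd? a ≢ odd? c
    consecutive-parity (inj₁ refl) same = not-¬ refl (sym same)
    consecutive-parity (inj₂ refl) same = not-¬ refl same

  parityClass-true∩A=∅ : Disjoint (parityClass true) A
  parityClass-true∩A=∅ x x∈ with parityClass⁻ x∈
  ... | i , refl , odd?i = ¬-not λ Avᵢ →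
    contradiction (subst (λ j → odd? (toℕ j) ≡ true) (index-in-A P i Avᵢ) odd?i) λ ()

  -- I₀ contains the last vertex of P, which the switch moves into the second set.
  I₀ J₀ : Subset n
  I₀ = parityClass (odd? k)
  J₀ = parityClass (not (odd? k))

  J₀∩B=∅ : Disjoint J₀ B
  J₀∩B=∅ x x∈ with parityClass⁻ x∈
  ... | i , refl , odd?i = ¬-not λ Bvᵢ → not-¬ refl
    (trans (cong odd? (sym (toℕ-fromℕ k)))
           (subst (λ j → odd? (toℕ j) ≡ not (odd? k)) (index-in-B P i Bvᵢ) odd?i))

  path⊆I₀△J₀ : ∀ i → lookup (I₀ △ J₀) (v P i) ≡ true
  path⊆I₀△J₀ i with odd? (toℕ i) Bool.≟ odd? k
  ... | yes same = trans (lookup-△ I₀ J₀ (v P i))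
        (cong₂ _xor_ (subst (λ b → lookup (parityClass b) (v P i) ≡ true) same (vertex∈parityClass i))
                     (vertex∉parityClass (not-¬ same)))
  ... | no differ = trans (lookup-△ I₀ J₀ (v P i))
        (cong₂ _xor_ (vertex∉parityClass differ)
                     (subst (λ b → lookup (parityClass b) (v P i) ≡ true) (¬-not differ) (vertex∈parityClass i)))

  last∈switched-J₀ : lookup (J₀ △ closure (I₀ △ J₀)) (v P last) ≡ true
  last∈switched-J₀ = trans (lookup-△ J₀ _ (v P last)) (cong₂ _xor_ last∉J₀ last∈C₀)
    where
    last∉J₀ : lookup J₀ (v P last) ≡ false
    last∉J₀ = vertex∉parityClass (not-¬ (cong odd? (toℕ-fromℕ k)))
    last∈C₀ : lookup (closure (I₀ △ J₀)) (v P last) ≡ true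
    last∈C₀ = Reachability.path-inside-reaches G A (I₀ △ J₀) P path⊆I₀△J₀

  last∈B : lookup B (v P last) ≡ true
  last∈B = to ∈⇔lookup (lastB P)

  even-witness : Even k →
                 indepPair G ∅ (A ∪ B) (I₀ , J₀) ≡ true × indepPair G A B (switch (I₀ , J₀)) ≡ false
  even-witness even =
    from (indepPair⇔ G ∅ (A ∪ B) I₀ J₀)
      ( (disjoint-∅ I₀ , parityClass-independent _)
      , (from (disjoint-∪⇔ J₀ A B) (J₀∩A=∅ , J₀∩B=∅) , parityClass-independent _))
    , trans (cong (indepIn G A (I₀ △ closure (I₀ △ J₀)) ∧_)
                  (indepIn-false G B (J₀ △ closure (I₀ △ J₀)) last∈switched-J₀ last∈B))
            (∧-zeroʳ _)
    where
    J₀∩A=∅ : Disjoint J₀ A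
    J₀∩A=∅ =
      subst (λ b → Disjoint (parityClass b) A) (sym (cong not (Even⇒odd?≡false even))) parityClass-true∩A=∅

  odd-witness : Odd k →
                indepPair G A B (I₀ , J₀) ≡ true × indepPair G ∅ (A ∪ B) (switch (I₀ , J₀)) ≡ false
  odd-witness odd =
    from (indepPair⇔ G A B I₀ J₀)
      ((I₀∩A=∅ , parityClass-independent _) , (J₀∩B=∅ , parityClass-independent _))
    , trans (cong (indepIn G ∅ (I₀ △ closure (I₀ △ J₀)) ∧_)
                  (indepIn-false G (A ∪ B) (J₀ △ closure (I₀ △ J₀)) last∈switched-J₀ last∈A∪B))
            (∧-zeroʳ _)
    where
    I₀∩A=∅ : Disjoint I₀ A
    I₀∩A=∅ = subst (λ b → Disjoint (parityClass b) A) (sym (Odd⇒odd?≡true odd)) parityClass-true∩A=∅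
    last∈A∪B : lookup (A ∪ B) (v P last) ≡ true
    last∈A∪B = trans (lookup-∪ A B (v P last)) (trans (cong (lookup A (v P last) ∨_) last∈B) (∨-zeroʳ _))

theorem3p1 : ∀ {n : ℕ} (G : Graph n) (A B : Subset n) →
    (PEven G A B → Δ G A B ℤ.< 0ℤ) × (PInfinite G A B → Δ G A B ≡ 0ℤ) × (POdd G A B → Δ G A B ℤ.> 0ℤ)
theorem3p1 G A B = even-case , infinite-case , odd-case
  where
  open Switching G A B

  even-case : PEven G A B → Δ G A B ℤ.< 0ℤ
  even-case (P , all-even) = subst (ℤ._< 0ℤ) (sym (Δ≡count⊖count G A B))
    (m<n⇒m⊖n<0 (uncurry (count₁<count₂ (Even⇒¬Odd ∘ all-even) (I₀ , J₀)) (even-witness (all-even P))))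
    where open Witness P

  infinite-case : PInfinite G A B → Δ G A B ≡ 0ℤ
  infinite-case no-path = trans (Δ≡count⊖count G A B)
    (trans (cong (_⊖ count (indepPair G ∅ (A ∪ B))) (≤-antisym (count₁≤count₂ (λ P _ → no-path P))
                                                                (count₂≤count₁ (λ P _ → no-path P))))
           (n⊖n≡0 (count (indepPair G ∅ (A ∪ B)))))

  odd-case : POdd G A B → Δ G A B ℤ.> 0ℤ
  odd-case (P , all-odd) = subst (0ℤ ℤ.<_) (sym (Δ≡count⊖count G A B))
    (n<m⇒m⊖n>0 (uncurry (count₂<count₁ (λ Q even → Even⇒¬Odd even (all-odd Q)) (I₀ , J₀))
                        (odd-witness (all-odd P))))
    where open Witness P
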